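{- Let $n\geq 3$ and let $1,2,\ldots,s_{\delta(n)},s_{\delta(n)+1}=n$ be an addition chain producing $n$ of length $\delta(n)$, with associated generators $2=1+1,\ldots,s_{\delta(n)}=a_{\delta(n)}+r_{\delta(n)},\ s_{\delta(n)+1}=a_{\delta(n)+1}+r_{\delta(n)+1}=n$, where $a_2=r_2=1$ and $a_{i+1}=a_i+r_i$. Then \[\sum_{j=2}^{\delta(n)+1} s_j\geq 2n-2.\]
   Context: An addition chain of length $k-1$ producing $n$ is a sequence $1=s_1,2=s_2,\ldots,s_{k-1},s_k=n$ in which each term $s_j$ ($j\geq 3$) is the sum of two earlier terms. In this paper each term is written via a partition $s_i=a_i+r_i$ ($2\leq i\leq k$), called the $i$-th generator, with $2=1+1$ (i.e. $a_2=r_2=1$) and $a_{i+1}=a_i+r_i$; $a_i$ is the determiner and $r_i$ the regulator of the $i$-th generator. Here $k-1=\delta(n)$. -}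

module Defs where

open import Data.Nat using (ℕ; zero; suc; _+_; _≤_; _<_)
open import Data.Product using (∃-syntax; _×_)
open import Relation.Binary.PropositionalEquality using (_≡_)

-- Its length is k - 1 (= δ(n) in the paper).
record AdditionChain (n : ℕ) : Set where
  field
    k      : ℕ
    s      : ℕ → ℕ
    2≤k    : 2 ≤ k
    s-one  : s 1 ≡ 1
    s-two  : s 2 ≡ 2
    s-last : s k ≡ n
    s-sum  : ∀ j → 3 ≤ j → j ≤ k →
             ∃[ p ] ∃[ q ] (1 ≤ p × p < j × 1 ≤ q × q < j × s j ≡ s p + s q)

record Generators {n : ℕ} (c : AdditionChain n) : Set where
  open AdditionChain c
  field
    a      : ℕ → ℕ
    r      : ℕ → ℕ
    a-two  : a 2 ≡ 1
    r-two  : r 2 ≡ 1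
    s-gen  : ∀ i → 2 ≤ i → i ≤ k → s i ≡ a i + r i
    a-step : ∀ i → 2 ≤ i → i < k → a (suc i) ≡ a i + r i

sumRange : (ℕ → ℕ) → ℕ → ℕ → ℕ
sumRange f lo zero    = 0
sumRange f lo (suc m) = f lo + sumRange f (suc lo) m

module Submission where

-- The generator recursion
-- makes the chain non-decreasing: s_{i+1} = a_{i+1} + r_{i+1} ≥ a_{i+1}
-- = a_i + r_i = s_i.  Hence every term is at most twice its predecessor,
-- since it is a sum of two earlier terms, each bounded by the predecessor.
-- For any sequence with this doubling property, induction gives
--   2·f(lo+m) ≤ f(lo) + f(lo) + f(lo+1) + ... + f(lo+m),
-- because 2·f(lo+m+1) ≤ f(lo+m+1) + 2·f(lo+m).  Taking lo = 2 (where
-- s_2 = 2) and lo + m = k (where s_k = n) gives 2n ≤ 2 + Σ_{j=2}^{k} s_j,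
-- which is the claim.

open import Defs
open import Data.Nat using (ℕ; _*_; _∸_; _≤_)
open import Data.Nat using (zero; suc; _+_; _<_; z≤n; s≤s; s≤s⁻¹; _≤′_; ≤′-refl; ≤′-step)
open import Data.Nat.Properties
open import Data.Product using (_,_)
open import Relation.Binary.PropositionalEquality

sumRange-snoc : ∀ f lo m → sumRange f lo (suc m) ≡ sumRange f lo m + f (lo + m)
sumRange-snoc f lo zero = trans (+-identityʳ (f lo)) (cong f (sym (+-identityʳ lo)))
sumRange-snoc f lo (suc m) = begin
    f lo + sumRange f (suc lo) (suc m)
  ≡⟨ cong (f lo +_) (sumRange-snoc f (suc lo) m) ⟩
    f lo + (sumRange f (suc lo) m + f (suc lo + m))
  ≡⟨ sym (+-assoc (f lo) _ _) ⟩
    f lo + sumRange f (suc lo) m + f (suc lo + m)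
  ≡⟨ cong (λ x → f lo + sumRange f (suc lo) m + f x) (sym (+-suc lo m)) ⟩
    f lo + sumRange f (suc lo) m + f (lo + suc m) ∎
  where open ≡-Reasoning

stepwise-monotone : ∀ (f : ℕ → ℕ) lo hi →
  (∀ i → lo ≤ i → suc i ≤ hi → f i ≤ f (suc i)) →
  ∀ {p q} → lo ≤ p → p ≤′ q → q ≤ hi → f p ≤ f q
stepwise-monotone f lo hi step lo≤p ≤′-refl q≤hi = ≤-refl
stepwise-monotone f lo hi step {p} {suc q} lo≤p (≤′-step p≤′q) q<hi =
  ≤-trans (stepwise-monotone f lo hi step lo≤p p≤′q (≤-trans (n≤1+n q) q<hi))
          (step q (≤-trans lo≤p (≤′⇒≤ p≤′q)) q<hi)

doubling-bound : ∀ (f : ℕ → ℕ) lo m →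
  (∀ i → lo ≤ i → i < lo + m → f (suc i) ≤ 2 * f i) →
  2 * f (lo + m) ≤ sumRange f lo (suc m) + f lo
doubling-bound f lo zero _ rewrite +-identityʳ lo =
  ≤-reflexive (trans (cong (f lo +_) (+-identityʳ (f lo)))
                     (cong (_+ f lo) (sym (+-identityʳ (f lo)))))
doubling-bound f lo (suc m) double = begin
    2 * x                   ≡⟨ cong (x +_) (+-identityʳ x) ⟩
    x + x                   ≤⟨ +-monoʳ-≤ x x≤twice-previous ⟩
    x + (S + f lo)          ≡⟨ sym (+-assoc x S (f lo)) ⟩
    x + S + f lo            ≡⟨ cong (_+ f lo) (+-comm x S) ⟩
    S + x + f lo            ≡⟨ cong (_+ f lo) (sym (sumRange-snoc f lo (suc m))) ⟩
    sumRange f lo (suc (suc m)) + f lo ∎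
  where
  open ≤-Reasoning
  x = f (lo + suc m)
  S = sumRange f lo (suc m)
  lo+m<lo+suc-m : lo + m < lo + suc m
  lo+m<lo+suc-m = +-monoʳ-< lo (n<1+n m)
  x≤twice-previous : x ≤ S + f lo
  x≤twice-previous = begin
    x                  ≡⟨ cong f (+-suc lo m) ⟩
    f (suc (lo + m))   ≤⟨ double (lo + m) (m≤m+n lo m) lo+m<lo+suc-m ⟩
    2 * f (lo + m)     ≤⟨ doubling-bound f lo m (λ i lo≤i i<lo+m →
                            double i lo≤i (<-trans i<lo+m lo+m<lo+suc-m)) ⟩
    S + f lo ∎

module _ {n : ℕ} (c : AdditionChain n) (g : Generators c) where
  open AdditionChain c
  open Generators g

  chain-step : ∀ i → 1 ≤ i → suc i ≤ k → s i ≤ s (suc i)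
  chain-step (suc zero) _ _ rewrite s-one | s-two = s≤s z≤n
  chain-step (suc (suc i)) _ i<k = begin
      s j                      ≡⟨ s-gen j (s≤s (s≤s z≤n)) (≤-trans (n≤1+n j) i<k) ⟩
      a j + r j                ≡⟨ sym (a-step j (s≤s (s≤s z≤n)) i<k) ⟩
      a (suc j)                ≤⟨ m≤m+n _ _ ⟩
      a (suc j) + r (suc j)    ≡⟨ sym (s-gen (suc j) (s≤s (s≤s z≤n)) i<k) ⟩
      s (suc j) ∎
    where
    open ≤-Reasoning
    j = suc (suc i)

  chain-monotone : ∀ p j → 1 ≤ p → p < suc j → suc j ≤ k → s p ≤ s j
  chain-monotone p j 1≤p p<j+1 j<k =
    stepwise-monotone s 1 k chain-step 1≤p (≤⇒≤′ (s≤s⁻¹ p<j+1)) (≤-trans (n≤1+n j) j<k)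

  -- Each term is a sum of two earlier terms, so at most twice its predecessor.
  chain-doubling : ∀ i → 2 ≤ i → i < k → s (suc i) ≤ 2 * s i
  chain-doubling i 2≤i i<k with s-sum (suc i) (s≤s 2≤i) i<k
  ... | p , q , 1≤p , p<i+1 , 1≤q , q<i+1 , s-i+1≡ = begin
      s (suc i)     ≡⟨ s-i+1≡ ⟩
      s p + s q     ≤⟨ +-mono-≤ (chain-monotone p i 1≤p p<i+1 i<k)
                                (chain-monotone q i 1≤q q<i+1 i<k) ⟩
      s i + s i     ≡⟨ cong (s i +_) (sym (+-identityʳ (s i))) ⟩
      2 * s i ∎
    where open ≤-Reasoning

proposition2p9 : (n : ℕ) → 3 ≤ n → (c : AdditionChain n) → Generators c →
    2 * n ∸ 2 ≤ sumRange (AdditionChain.s c) 2 (AdditionChain.k c ∸ 1)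
proposition2p9 n _ c g = m≤n+o⇒m∸n≤o (2 * n) 2 (begin
    2 * n                        ≡⟨ cong (2 *_) (sym (trans (cong s 2+m≡k) s-last)) ⟩
    2 * s (2 + m)                ≤⟨ doubling-bound s 2 m (λ i 2≤i i<2+m →
                                      chain-doubling c g i 2≤i (<-≤-trans i<2+m 2+m≤k)) ⟩
    sumRange s 2 (suc m) + s 2   ≡⟨ cong₂ _+_ (cong (sumRange s 2) (cong (_∸ 1) 2+m≡k)) s-two ⟩
    sumRange s 2 (k ∸ 1) + 2     ≡⟨ +-comm _ 2 ⟩
    2 + sumRange s 2 (k ∸ 1) ∎)
  where
  open AdditionChain c
  open ≤-Reasoning
  m = k ∸ 2
  2+m≡k : 2 + m ≡ k
  2+m≡k = m+[n∸m]≡n 2≤k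
  2+m≤k : 2 + m ≤ k
  2+m≤k = ≤-reflexive 2+m≡k
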